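{- There exist a finite graded poset $P$ with minimum $\hat0$ and two CW-labelings $\lambda_1$ and $\lambda_2$ of $P$ such that the posets $Q_{\lambda_1}(P)$ and $Q_{\lambda_2}(P)$ are not isomorphic.
   Context: All posets are finite, graded, with minimum $\hat0$; $\rho$ is rank. C-labelings. A C-labeling gives each pair (maximal chain $\mathbf m$, cover $e$ in $\mathbf m$) a label $\lambda(\mathbf m,e)$ in a poset $\Lambda$, such that maximal chains agreeing along their bottom $d$ edges have equal labels there. Saturated chains from $\hat0$ thus have well-defined labels; such a chain has an ascent at rank $i$ if the label at rank $i$ is less than the label at rank $i+1$. A rooted interval $[x,y]_{\mathbf r}$ is an interval with a saturated chain $\mathbf r$ from $\hat0$ to $x$. A maximal chain $\mathbf c$ of $[x,y]$ is increasing (resp. ascent-free) if $\mathbf r\cup\mathbf c$ has an ascent at every (resp. no) rank strictly between $\rho(x)$ and $\rho(y)$. A CR-labeling is one where each rooted interval has exactly one increasing maximal chain. Rank two switching property. For every maximal chain $\mathbf m:\hat0=m_0\lessdot\cdots\lessdot m_k$ with an ascent at rank $i$, there is a unique $m_i'\ne m_i$ such that replacing $m_i$ by $m_i'$ yields a maximal chain with the same labels except that the labels at ranks $i,i+1$ are swapped; $m_i'$ depends only on $m_0,\dots,m_{i+1}$. This replacement (on saturated chains from $\hat0$) is a quadratic exchange. A CW-labeling is a CR-labeling with the rank two switching property such that, in every rooted interval, distinct ascent-free maximal chains have distinct words of labels (the labels being those of $\mathbf r\cup\mathbf c$ at ranks strictly between $\rho(x)$ and $\rho(y)$). $Q_\lambda(P)$.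 $C(P)$ is the set of saturated chains from $\hat0$ ordered by inclusion. Chains are equivalent if they have the same top element and are related by quadratic exchanges and their inverses. $Q_\lambda(P)$ is the set of classes, with $X\le Y$ iff $\mathbf x=\mathbf z_0\le\mathbf z_1\sim\mathbf z_2\le\cdots\sim\mathbf z_{2k}\le\mathbf z_{2k+1}=\mathbf y$ for some $\mathbf x\in X$, $\mathbf y\in Y$, $\mathbf z_j\in C(P)$. -}

module Defs where

open import Level using (0ℓ)
open import Data.Nat using (ℕ; zero; suc; _∸_; _<_; _≤_)
open import Data.Nat.Properties using (_≟_)
open import Data.Fin using (Fin)
open import Data.List using (List; []; _∷_; _++_; length; take)
open import Data.List.Membership.Propositional using (_∈_)
open import Data.Maybe using (Maybe; just; nothing)
open import Data.Product using (Σ; _×_; _,_; ∃; ∃-syntax)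
open import Data.Sum using (_⊎_)
open import Data.Unit using (⊤)
open import Relation.Nullary using (¬_; yes; no)
open import Relation.Binary.PropositionalEquality using (_≡_; _≢_)
open import Relation.Binary.Structures using (IsPartialOrder)
open import Relation.Binary.Construct.Closure.Equivalence using (EqClosure)

Covers : {A : Set} → (A → A → Set) → A → A → Set
Covers {A} _≤_ x y =
  (x ≤ y) × (x ≢ y) × (∀ z → x ≤ z → z ≤ y → (z ≡ x) ⊎ (z ≡ y))

nth : {A : Set} → List A → ℕ → Maybe A
nth []       _       = nothing
nth (a ∷ as) zero    = just a
nth (a ∷ as) (suc k) = nth as k

replaceAt : {A : Set} → ℕ → A → List A → List A
replaceAt _       z []       = []
replaceAt zero    z (a ∷ as) = z ∷ as
replaceAt (suc k) z (a ∷ as) = a ∷ replaceAt k z as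

lastOr : {A : Set} → A → List A → A
lastOr d []       = d
lastOr d (a ∷ as) = lastOr a as

swapRank : ℕ → ℕ → ℕ
swapRank i j with j ≟ i
... | yes _ = suc i
... | no  _ with j ≟ suc i
...   | yes _ = i
...   | no  _ = j

-- Finite graded posets with minimum.  Elements are Fin n (finiteness);
-- graded = there is a rank function ρ with ρ 0̂ = 0 and ρ y = ρ x + 1
-- whenever x ⋖ y.

record GradedPoset : Set₁ where
  field
    n              : ℕ
    _≤P_           : Fin n → Fin n → Set
    isPartialOrder : IsPartialOrder _≡_ _≤P_
    bot            : Fin n
    bot-min        : ∀ x → bot ≤P x
    ρ              : Fin n → ℕ
    ρ-bot          : ρ bot ≡ 0
    ρ-cover        : ∀ {x y} → Covers _≤P_ x y → ρ y ≡ suc (ρ x)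

record LabelPoset : Set₁ where
  field
    Carrier        : Set
    _≤Λ_           : Carrier → Carrier → Set
    isPartialOrder : IsPartialOrder _≡_ _≤Λ_

  _<Λ_ : Carrier → Carrier → Set
  a <Λ b = (a ≤Λ b) × (a ≢ b)

module _ (P : GradedPoset) where
  open GradedPoset P

  Elt : Set
  Elt = Fin n

  _⋖_ : Elt → Elt → Set
  _⋖_ = Covers _≤P_

  -- A chain  x ⋖ c₁ ⋖ c₂ ⋖ ... ⋖ c_k  is represented by x and the list
  -- [c₁, ..., c_k].  A saturated chain from 0̂ is represented by the
  -- list of its elements above 0̂, so the element of rank i is at
  -- position i-1 and the length of the list is the rank of its top.
  CoverPath : Elt → List Elt → Set
  CoverPath x []       = ⊤
  CoverPath x (y ∷ ys) = (x ⋖ y) × CoverPath y ys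

  SatChain : List Elt → Set
  SatChain s = CoverPath bot s

  top : List Elt → Elt
  top s = lastOr bot s

  MaxChain : List Elt → Set
  MaxChain m = SatChain m × (∀ z → ¬ (top m ⋖ z))

  -- chain inclusion (as sets of elements; 0̂ belongs to every chain)
  _⊆C_ : List Elt → List Elt → Set
  s ⊆C t = ∀ a → a ∈ s → a ∈ t

  module _ (Λ : LabelPoset) where
    open LabelPoset Λ

    -- A labeling assigns to a maximal chain m and the cover of m going
    -- from rank i to rank i+1 (given by i : ℕ, i < length m) a label.
    -- Values outside this range are irrelevant.
    Labeling : Set
    Labeling = List Elt → ℕ → Carrier

    module _ (lab : Labeling) where

      -- label at rank i (i ≥ 1) = label of the cover m_{i-1} ⋖ m_i
      labelAt : List Elt → ℕ → Carrier
      labelAt m i = lab m (i ∸ 1)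

      IsCLabeling : Set
      IsCLabeling = ∀ m m' → MaxChain m → MaxChain m' → ∀ d →
        d ≤ length m → d ≤ length m' → take d m ≡ take d m' →
        ∀ i → i < d → lab m i ≡ lab m' i

      AscentAt : List Elt → ℕ → Set
      AscentAt m i = labelAt m i <Λ labelAt m (suc i)

      SAscentAt : List Elt → ℕ → Set
      SAscentAt s i = Σ (List Elt) λ t → MaxChain (s ++ t) × AscentAt (s ++ t) i

      -- rooted interval [top r, y]_r : SatChain r and top r ≤ y.
      -- maximal chains of [x , y]
      IntervalMaxChain : Elt → Elt → List Elt → Set
      IntervalMaxChain x y c = CoverPath x c × lastOr x c ≡ y

      Increasing : List Elt → Elt → List Elt → Set
      Increasing r y c = ∀ i → ρ (top r) < i → i < ρ y → SAscentAt (r ++ c) i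

      AscentFree : List Elt → Elt → List Elt → Set
      AscentFree r y c = ∀ i → ρ (top r) < i → i < ρ y → ¬ SAscentAt (r ++ c) i

      IsCRLabeling : Set
      IsCRLabeling = IsCLabeling ×
        (∀ r y → SatChain r → top r ≤P y →
          Σ (List Elt) λ c → (IntervalMaxChain (top r) y c × Increasing r y c) ×
            (∀ c' → IntervalMaxChain (top r) y c' → Increasing r y c' → c' ≡ c))

      -- z is a switching element for m at rank i: replacing m_i by z
      -- (z ≠ m_i) gives a maximal chain whose labels are those of m with
      -- the labels at ranks i and i+1 swapped
      Switch : List Elt → ℕ → Elt → Set
      Switch m i z =
        (nth m (i ∸ 1) ≢ just z) ×
        MaxChain (replaceAt (i ∸ 1) z m) ×
        (∀ j → 1 ≤ j → j ≤ length m →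
           labelAt (replaceAt (i ∸ 1) z m) j ≡ labelAt m (swapRank i j))

      RankTwoSwitching : Set
      RankTwoSwitching =
        (∀ m i → MaxChain m → 1 ≤ i → i < length m → AscentAt m i →
           Σ Elt λ z → Switch m i z × (∀ z' → Switch m i z' → z' ≡ z)) ×
        -- m_i' depends only on m_0, ..., m_{i+1}
        (∀ m m̃ i z z̃ → MaxChain m → MaxChain m̃ → 1 ≤ i → i < length m →
           i < length m̃ → AscentAt m i → AscentAt m̃ i →
           take (suc i) m ≡ take (suc i) m̃ →
           Switch m i z → Switch m̃ i z̃ → z ≡ z̃)

      IsCWLabeling : Set
      IsCWLabeling = IsCRLabeling × RankTwoSwitching ×
        (∀ r y → SatChain r → top r ≤P y →
          ∀ c c' t t' → IntervalMaxChain (top r) y c → IntervalMaxChain (top r) y c' →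
          AscentFree r y c → AscentFree r y c' →
          MaxChain ((r ++ c) ++ t) → MaxChain ((r ++ c') ++ t') →
          (∀ i → ρ (top r) < i → i < ρ y →
             labelAt ((r ++ c) ++ t) i ≡ labelAt ((r ++ c') ++ t') i) →
          c ≡ c')

      QuadExchange : List Elt → List Elt → Set
      QuadExchange s s' = SatChain s ×
        Σ ℕ λ i → Σ (List Elt) λ t → Σ Elt λ z →
          1 ≤ i × i < length s × MaxChain (s ++ t) × AscentAt (s ++ t) i ×
          Switch (s ++ t) i z × s' ≡ replaceAt (i ∸ 1) z s

      _∼_ : List Elt → List Elt → Set
      s ∼ s' = SatChain s × SatChain s' × top s ≡ top s' × EqClosure QuadExchange s s'

      -- zigzags  x = z₀ ≤ z₁ ∼ z₂ ≤ ⋯ ∼ z_{2k} ≤ z_{2k+1} = y  in C(P)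
      data Zigzag : List Elt → List Elt → Set where
        zz-end  : ∀ {x y} → SatChain x → SatChain y → x ⊆C y → Zigzag x y
        zz-step : ∀ {x z₁ z₂ y} → SatChain x → x ⊆C z₁ → z₁ ∼ z₂ →
                  Zigzag z₂ y → Zigzag x y

      -- the order of Q_λ(P), on representatives of the classes:
      -- [a] ≤ [b]  iff  some x ∼ a and y ∼ b are joined by a zigzag
      _≤Q_ : List Elt → List Elt → Set
      a ≤Q b = Σ (List Elt) λ x → Σ (List Elt) λ y → x ∼ a × y ∼ b × Zigzag x y

  -- Q_{λ₁}(P) ≅ Q_{λ₂}(P): a bijection between the sets of equivalence
  -- classes (given on representatives) preserving and reflecting order.
  QIso : (Λ₁ : LabelPoset) → Labeling Λ₁ → (Λ₂ : LabelPoset) → Labeling Λ₂ → Set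
  QIso Λ₁ l₁ Λ₂ l₂ =
    Σ (List Elt → List Elt) λ f → Σ (List Elt → List Elt) λ g →
      (∀ s → SatChain s → SatChain (f s)) ×
      (∀ s → SatChain s → SatChain (g s)) ×
      (∀ s s' → _∼_ Λ₁ l₁ s s' → _∼_ Λ₂ l₂ (f s) (f s')) ×
      (∀ s s' → _∼_ Λ₂ l₂ s s' → _∼_ Λ₁ l₁ (g s) (g s')) ×
      (∀ s → SatChain s → _∼_ Λ₁ l₁ (g (f s)) s) ×
      (∀ s → SatChain s → _∼_ Λ₂ l₂ (f (g s)) s) ×
      (∀ s s' → SatChain s → SatChain s' →
         (_≤Q_ Λ₁ l₁ s s' → _≤Q_ Λ₂ l₂ (f s) (f s')) ×
         (_≤Q_ Λ₂ l₂ (f s) (f s') → _≤Q_ Λ₁ l₁ s s'))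

module Submission where

-- The invariant is a *crown*: two incomparable elements with two distinct common
-- upper bounds.  For any graded P, an isomorphism Q_{λ₁}(P) ≅ Q_{λ₂}(P) reflects
-- crowns (crown-reflected); and a class map κ from saturated chains to a finite
-- order, invariant under exchanges and monotone for inclusion, computes Q_λ(P)
-- once it has suitable representatives (Quotient.ClassMap).
--
-- P has atoms a₁ b₁ c₁ and tops t₂ > a₁ b₁ c₁, u₂ > b₁ c₁.  A labeling of P by a
-- label of each cover (EdgeLabeling) is CW as soon as three finite conditions
-- hold, and its exchanges swap the atom of an increasing flag; a finite table
-- then describes Q_λ(P).  For λ₂ the classes of b₁, c₁ lie below both flag
-- classes through b₁, a crown; the order of Q_{λ₁}(P) is a path without one.

open import Defs hiding (_⋖_)
open import Data.Bool using (Bool; T; _∨_; _∧_)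
open import Data.Empty using (⊥-elim)
open import Data.Fin using (Fin; zero; suc; #_; toℕ)
open import Data.Fin.Properties using (all?; any?) renaming (_≟_ to _≟ᶠ_)
open import Data.List using (List; []; _∷_; _++_; length; take; lookup)
open import Data.Bool.ListAction using (any)
open import Data.List.Membership.Propositional using (_∈_; find)
open import Data.List.Properties as ListProperties using (take-take)
open import Data.List.Relation.Unary.All as All using (All)
open import Data.List.Relation.Unary.Any as Any using (Any; here)
open import Data.Maybe using (just)
open import Data.Maybe.Properties using (just-injective)
open import Data.Nat using (ℕ; zero; suc; _+_; _≤_; _<_; z≤n; s≤s; s≤s⁻¹; _≤?_; _≡ᵇ_)
open import Data.Nat.Properties
  using (≤-isPartialOrder; ≤-trans; <-irrefl; m+n≮n; +-suc; +-identityʳ; m≤n⇒m⊓n≡m)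
  renaming (_≟_ to _≟ℕ_)
open import Data.Product using (Σ; _×_; _,_; proj₁; proj₂; uncurry)
open import Data.Sum using (_⊎_; inj₁; inj₂)
open import Data.Unit using (tt)
import Data.List.Membership.DecPropositional as DecMembership
import Data.List.Relation.Binary.Subset.DecPropositional as DecSubset
open import Function using (_∘_)
open import Relation.Nullary using (¬_; Dec; yes; no)
open import Relation.Nullary.Decidable
  using (from-yes; _×-dec_; _⊎-dec_; _→-dec_; ¬?; T?; map′)
open import Relation.Binary.PropositionalEquality
  using (_≡_; _≢_; refl; sym; trans; cong; subst; subst₂; isEquivalence; module ≡-Reasoning)
open import Relation.Binary.Structures using (IsPartialOrder)
open import Relation.Binary.Construct.Closure.Equivalence using (symmetric; transitive; gfold)
open import Relation.Binary.Construct.Closure.ReflexiveTransitive using (ε; _◅_)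
open import Relation.Binary.Construct.Closure.Symmetric using (fwd)

take-prefix : ∀ {A : Set} {n d} (xs ys : List A) →
              n ≤ d → take d xs ≡ take d ys → take n xs ≡ take n ys
take-prefix {n = n} {d} xs ys n≤d eq = begin
  take n xs              ≡⟨ shorter xs ⟨
  take n (take d xs)     ≡⟨ cong (take n) eq ⟩
  take n (take d ys)     ≡⟨ shorter ys ⟩
  take n ys              ∎
  where
  open ≡-Reasoning
  shorter : ∀ zs → take n (take d zs) ≡ take n zs
  shorter zs = trans (take-take n d zs) (cong (λ k → take k zs) (m≤n⇒m⊓n≡m n≤d))

module GradedChains (P : GradedPoset) where
  open GradedPoset P using (ρ; ρ-cover)

  rank-along : ∀ {x} c → CoverPath P x c → ρ (lastOr x c) ≡ length c + ρ x
  rank-along []      _              = refl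
  rank-along {x} (y ∷ c) (x⋖y , path) = begin
    ρ (lastOr y c)        ≡⟨ rank-along c path ⟩
    length c + ρ y        ≡⟨ cong (length c +_) (ρ-cover x⋖y) ⟩
    length c + suc (ρ x)  ≡⟨ +-suc (length c) (ρ x) ⟩
    suc (length c + ρ x)  ∎
    where open ≡-Reasoning

  short-chain : ∀ {x y} c → CoverPath P x c → lastOr x c ≡ y → ρ y ≤ suc (ρ x) →
                (c ≡ [] × x ≡ y) ⊎ (c ≡ y ∷ [] × x ≢ y)
  short-chain []          _              last _ = inj₁ (refl , last)
  short-chain (w ∷ [])    ((_ , x≢w , _) , _) refl _ = inj₂ (refl , x≢w)
  short-chain {x} (w ∷ v ∷ vs) path refl short =
    ⊥-elim (m+n≮n (length vs) (ρ x)
             (s≤s⁻¹ (subst (_≤ suc (ρ x)) (rank-along (w ∷ v ∷ vs) path) short)))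

  short-unique : ∀ {x y c c'} → ρ y ≤ suc (ρ x) →
                 CoverPath P x c → lastOr x c ≡ y →
                 CoverPath P x c' → lastOr x c' ≡ y → c ≡ c'
  short-unique {c = c} {c'} short path last path' last'
    with short-chain c path last short | short-chain c' path' last' short
  ... | inj₁ (refl , _)   | inj₁ (refl , _)   = refl
  ... | inj₂ (refl , _)   | inj₂ (refl , _)   = refl
  ... | inj₁ (_ , x≡y)    | inj₂ (_ , x≢y)    = ⊥-elim (x≢y x≡y)
  ... | inj₂ (_ , x≢y)    | inj₁ (_ , x≡y)    = ⊥-elim (x≢y x≡y)

module Quotient (P : GradedPoset) (Λ : LabelPoset) (lab : Labeling P Λ) where

  Chain : Set
  Chain = List (Elt P)

  _≈_ : Chain → Chain → Set
  _≈_ = _∼_ P Λ lab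

  _⊑_ : Chain → Chain → Set
  _⊑_ = _≤Q_ P Λ lab

  ≈-refl : ∀ {s} → SatChain P s → s ≈ s
  ≈-refl ss = ss , ss , refl , ε

  ≈-sym : ∀ {s s'} → s ≈ s' → s' ≈ s
  ≈-sym (ss , ss' , tops , eq) = ss' , ss , sym tops , symmetric (QuadExchange P Λ lab) eq

  ≈-trans : ∀ {s s' s''} → s ≈ s' → s' ≈ s'' → s ≈ s''
  ≈-trans (ss , _ , tops , eq) (_ , ss'' , tops' , eq') =
    ss , ss'' , trans tops tops' , transitive (QuadExchange P Λ lab) eq eq'

  ⊑-respects-≈ : ∀ {a a' b b'} → a' ≈ a → b' ≈ b → a ⊑ b → a' ⊑ b'
  ⊑-respects-≈ a'≈a b'≈b (x , y , x≈a , y≈b , zigzag) =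
    x , y , ≈-trans x≈a (≈-sym a'≈a) , ≈-trans y≈b (≈-sym b'≈b) , zigzag

  record Crown : Set where
    field
      x y z w : Chain
      sat-x : SatChain P x
      sat-y : SatChain P y
      sat-z : SatChain P z
      sat-w : SatChain P w
      x⋢y : ¬ x ⊑ y
      y⋢x : ¬ y ⊑ x
      x⊑z : x ⊑ z
      x⊑w : x ⊑ w
      y⊑z : y ⊑ z
      y⊑w : y ⊑ w
      z≉w : ¬ z ≈ w

  module ClassMap {K : Set} (κ : Chain → K) (_≤ₖ_ : K → K → Set)
    (≤ₖ-trans : ∀ {k l m} → k ≤ₖ l → l ≤ₖ m → k ≤ₖ m)
    (κ-respects : ∀ {s s'} → QuadExchange P Λ lab s s' → κ s ≡ κ s')
    (κ-monotone : ∀ {s s'} → SatChain P s → SatChain P s' → _⊆C_ P s s' → κ s ≤ₖ κ s')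
    where

    κ-invariant : ∀ {s s'} → s ≈ s' → κ s ≡ κ s'
    κ-invariant (_ , _ , _ , eq) = gfold isEquivalence κ κ-respects eq

    zigzag-sound : ∀ {s s'} → Zigzag P Λ lab s s' → κ s ≤ₖ κ s'
    zigzag-sound (zz-end ss ss' s⊆s') = κ-monotone ss ss' s⊆s'
    zigzag-sound (zz-step ss s⊆z₁ z₁≈z₂ rest) =
      ≤ₖ-trans (κ-monotone ss (proj₁ z₁≈z₂) s⊆z₁)
               (subst (_≤ₖ κ _) (sym (κ-invariant z₁≈z₂)) (zigzag-sound rest))

    sound : ∀ {s s'} → s ⊑ s' → κ s ≤ₖ κ s'
    sound (x , y , x≈s , y≈s' , zigzag) =
      subst₂ _≤ₖ_ (κ-invariant x≈s) (κ-invariant y≈s') (zigzag-sound zigzag)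

    ClassCrown : K → K → K → K → Set
    ClassCrown k l m n =
      ¬ k ≤ₖ l × ¬ l ≤ₖ k × k ≤ₖ m × k ≤ₖ n × l ≤ₖ m × l ≤ₖ n × m ≢ n

    module Complete (rep : K → Chain)
      (rep-≈ : ∀ {s} → SatChain P s → rep (κ s) ≈ s)
      (realised : ∀ {k l} → k ≤ₖ l →
                  Σ Chain λ s → SatChain P s × κ s ≡ l × _⊆C_ P (rep k) s)
      where

      complete : ∀ {s s'} → SatChain P s → SatChain P s' → κ s ≤ₖ κ s' → s ⊑ s'
      complete {s} {s'} ss ss' k≤l with realised k≤l
      ... | m , sm , κm≡ , rep⊆m =
        rep (κ s) , rep (κ s') , rep-≈ ss , rep-≈ ss' ,
        zz-step (proj₁ (rep-≈ ss)) rep⊆m m≈rep (zz-end sat-rep sat-rep (λ _ a∈ → a∈))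
        where
        m≈rep : m ≈ rep (κ s')
        m≈rep = ≈-sym (subst (λ k → rep k ≈ m) κm≡ (rep-≈ sm))
        sat-rep : SatChain P (rep (κ s'))
        sat-rep = proj₁ (rep-≈ ss')

      ≈-complete : ∀ {s s'} → SatChain P s → SatChain P s' → κ s ≡ κ s' → s ≈ s'
      ≈-complete {s} ss ss' κs≡κs' =
        ≈-trans (≈-sym (rep-≈ ss)) (subst (λ k → rep k ≈ _) (sym κs≡κs') (rep-≈ ss'))

      crown-of-classes : ∀ {x y z w} →
        SatChain P x → SatChain P y → SatChain P z → SatChain P w →
        ClassCrown (κ x) (κ y) (κ z) (κ w) → Crown
      crown-of-classes {x} {y} {z} {w} sx sy sz sw (k⋢l , l⋢k , k≤m , k≤n , l≤m , l≤n , m≢n) =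
        record
          { x = x ; y = y ; z = z ; w = w
          ; sat-x = sx ; sat-y = sy ; sat-z = sz ; sat-w = sw
          ; x⋢y = k⋢l ∘ sound
          ; y⋢x = l⋢k ∘ sound
          ; x⊑z = complete sx sz k≤m
          ; x⊑w = complete sx sw k≤n
          ; y⊑z = complete sy sz l≤m
          ; y⊑w = complete sy sw l≤n
          ; z≉w = m≢n ∘ κ-invariant
          }

      no-crown : (∀ k l m n → ¬ ClassCrown k l m n) → ¬ Crown
      no-crown crownless c = crownless _ _ _ _
        ( (λ k≤l → x⋢y (complete sat-x sat-y k≤l))
        , (λ l≤k → y⋢x (complete sat-y sat-x l≤k))
        , sound x⊑z , sound x⊑w , sound y⊑z , sound y⊑w
        , (λ m≡n → z≉w (≈-complete sat-z sat-w m≡n)) )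
        where open Crown c

crown-reflected : (P : GradedPoset) (Λ₁ : LabelPoset) (l₁ : Labeling P Λ₁)
                  (Λ₂ : LabelPoset) (l₂ : Labeling P Λ₂) →
                  QIso P Λ₁ l₁ Λ₂ l₂ → Quotient.Crown P Λ₂ l₂ → Quotient.Crown P Λ₁ l₁
crown-reflected P Λ₁ l₁ Λ₂ l₂ (f , g , _ , gs , f≈ , _ , _ , fg , order) c = record
  { x = g x ; y = g y ; z = g z ; w = g w
  ; sat-x = gs x sat-x ; sat-y = gs y sat-y ; sat-z = gs z sat-z ; sat-w = gs w sat-w
  ; x⋢y = x⋢y ∘ pull sat-x sat-y
  ; y⋢x = y⋢x ∘ pull sat-y sat-x
  ; x⊑z = push sat-x sat-z x⊑z
  ; x⊑w = push sat-x sat-w x⊑w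
  ; y⊑z = push sat-y sat-z y⊑z
  ; y⊑w = push sat-y sat-w y⊑w
  ; z≉w = λ gz≈gw → z≉w (Q₂.≈-trans (Q₂.≈-sym (fg z sat-z))
                          (Q₂.≈-trans (f≈ _ _ gz≈gw) (fg w sat-w)))
  }
  where
  module Q₁ = Quotient P Λ₁ l₁
  module Q₂ = Quotient P Λ₂ l₂
  open Q₂.Crown c

  push : ∀ {s s'} → SatChain P s → SatChain P s' → s Q₂.⊑ s' → g s Q₁.⊑ g s'
  push {s} {s'} ss ss' le =
    proj₂ (order (g s) (g s') (gs s ss) (gs s' ss')) (Q₂.⊑-respects-≈ (fg s ss) (fg s' ss') le)

  pull : ∀ {s s'} → SatChain P s → SatChain P s' → g s Q₁.⊑ g s' → s Q₂.⊑ s'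
  pull {s} {s'} ss ss' le =
    Q₂.⊑-respects-≈ (Q₂.≈-sym (fg s ss)) (Q₂.≈-sym (fg s' ss'))
      (proj₁ (order (g s) (g s') (gs s ss) (gs s' ss')) le)

-- The order on Fin (suc n) in which zero is the least element and the only other
-- strict relations are the listed pairs (a transitive order when no two pairs chain).
heightTwo : ∀ {n} → List (Fin (suc n) × Fin (suc n)) → Fin (suc n) → Fin (suc n) → Bool
heightTwo {n} edges k l = (toℕ k ≡ᵇ toℕ l) ∨ (toℕ k ≡ᵇ 0) ∨ any listed edges
  where
  listed : Fin (suc n) × Fin (suc n) → Bool
  listed (i , j) = (toℕ i ≡ᵇ toℕ k) ∧ (toℕ j ≡ᵇ toℕ l)

E : Set
E = Fin 6

pattern 0̂  = zero
pattern a₁ = suc zero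
pattern b₁ = suc (suc zero)
pattern c₁ = suc (suc (suc zero))
pattern t₂ = suc (suc (suc (suc zero)))
pattern u₂ = suc (suc (suc (suc (suc zero))))

_≼_ : E → E → Set
x ≼ y = T (heightTwo ((a₁ , t₂) ∷ (b₁ , t₂) ∷ (c₁ , t₂) ∷ (b₁ , u₂) ∷ (c₁ , u₂) ∷ []) x y)

_≼?_ : ∀ x y → Dec (x ≼ y)
x ≼? y = T? _

rank : E → ℕ
rank 0̂  = 0
rank a₁ = 1
rank b₁ = 1
rank c₁ = 1
rank t₂ = 2
rank u₂ = 2

_⋖_ : E → E → Set
_⋖_ = Covers _≼_

_⋖?_ : ∀ x y → Dec (x ⋖ y)
x ⋖? y = x ≼? y ×-dec ¬? (x ≟ᶠ y) ×-dec
         all? λ z → x ≼? z →-dec z ≼? y →-dec (z ≟ᶠ x ⊎-dec z ≟ᶠ y)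

≼-isPartialOrder : IsPartialOrder _≡_ _≼_
≼-isPartialOrder = record
  { isPreorder = record
    { isEquivalence = isEquivalence
    ; reflexive     = λ { {x} refl → ≼-refl x }
    ; trans         = λ {x} {y} {z} → ≼-trans x y z
    }
  ; antisym = λ {x} {y} → ≼-antisym x y
  }
  where
  ≼-refl : ∀ x → x ≼ x
  ≼-refl = from-yes (all? λ x → x ≼? x)
  ≼-trans : ∀ x y z → x ≼ y → y ≼ z → x ≼ z
  ≼-trans = from-yes (all? λ x → all? λ y → all? λ z → x ≼? y →-dec y ≼? z →-dec x ≼? z)
  ≼-antisym : ∀ x y → x ≼ y → y ≼ x → x ≡ y
  ≼-antisym = from-yes (all? λ x → all? λ y → x ≼? y →-dec y ≼? x →-dec x ≟ᶠ y)

P : GradedPoset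
P = record
  { n = 6 ; _≤P_ = _≼_ ; isPartialOrder = ≼-isPartialOrder
  ; bot = 0̂ ; bot-min = from-yes (all? λ x → 0̂ ≼? x)
  ; ρ = rank ; ρ-bot = refl
  ; ρ-cover = λ {x} {y} → rank-cover x y
  }
  where
  rank-cover : ∀ x y → x ⋖ y → rank y ≡ suc (rank x)
  rank-cover = from-yes (all? λ x → all? λ y → x ⋖? y →-dec rank y ≟ℕ suc (rank x))

open GradedChains P

Chain : Set
Chain = List E

no-long-chain : ∀ x y z → 0̂ ⋖ x → x ⋖ y → ¬ y ⋖ z
no-long-chain = from-yes (all? λ x → all? λ y → all? λ z → 0̂ ⋖? x →-dec x ⋖? y →-dec ¬? (y ⋖? z))

no-long-saturated : ∀ {x y z r} → ¬ SatChain P (x ∷ y ∷ z ∷ r)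
no-long-saturated (0̂⋖x , x⋖y , y⋖z , _) = no-long-chain _ _ _ 0̂⋖x x⋖y y⋖z

data Flag : E → Chain → Set where
  flag : ∀ {x y} → 0̂ ⋖ x → x ⋖ y → Flag y (x ∷ y ∷ [])

flag-maximal : ∀ {y m} → Flag y m → MaxChain P m
flag-maximal (flag 0̂⋖x x⋖y) = (0̂⋖x , x⋖y , tt) , λ z → no-long-chain _ _ z 0̂⋖x x⋖y

maximal-flag : ∀ {m} → MaxChain P m → Flag (top P m) m
maximal-flag {[]} (_ , maximal) = ⊥-elim (maximal a₁ (from-yes (0̂ ⋖? a₁)))
maximal-flag {x ∷ []} ((0̂⋖x , _) , maximal) with atom-covered x 0̂⋖x
  where
  atom-covered : ∀ x → 0̂ ⋖ x → Σ E (x ⋖_)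
  atom-covered = from-yes (all? λ x → 0̂ ⋖? x →-dec any? (x ⋖?_))
... | y , x⋖y = ⊥-elim (maximal y x⋖y)
maximal-flag {x ∷ y ∷ []} ((0̂⋖x , x⋖y , _) , _) = flag 0̂⋖x x⋖y
maximal-flag {_ ∷ _ ∷ _ ∷ _} (saturated , _) = ⊥-elim (no-long-saturated saturated)

interval-flag : ∀ {y c} → rank y ≡ 2 → CoverPath P 0̂ c → lastOr 0̂ c ≡ y → Flag y c
interval-flag {c = []} () _ refl
interval-flag {c = x ∷ []} rank≡2 (0̂⋖x , _) refl
  with trans (sym rank≡2) (GradedPoset.ρ-cover P 0̂⋖x)
... | ()
interval-flag {c = x ∷ y ∷ []} _ (0̂⋖x , x⋖y , _) refl = flag 0̂⋖x x⋖y
interval-flag {c = _ ∷ _ ∷ _ ∷ _} _ path _ = ⊥-elim (no-long-saturated path)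

rooted-cases : ∀ {r y} → SatChain P r → top P r ≼ y →
               rank y ≤ suc (rank (top P r)) ⊎ (r ≡ [] × rank y ≡ 2)
rooted-cases {[]} {y} _ _ with rank-of y
  where
  rank-of : ∀ y → rank y ≤ 1 ⊎ rank y ≡ 2
  rank-of = from-yes (all? λ y → rank y ≤? 1 ⊎-dec rank y ≟ℕ 2)
... | inj₁ ≤1  = inj₁ ≤1
... | inj₂ ≡2  = inj₂ (refl , ≡2)
rooted-cases {x ∷ r} {y} sr _ =
  inj₁ (subst (λ k → rank y ≤ suc k) (sym top-rank) (≤-trans (rank≤2 y) (s≤s (s≤s z≤n))))
  where
  rank≤2 : ∀ y → rank y ≤ 2
  rank≤2 = from-yes (all? λ y → rank y ≤? 2)
  top-rank : rank (top P (x ∷ r)) ≡ suc (length r)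
  top-rank = trans (rank-along (x ∷ r) sr) (cong suc (+-identityʳ (length r)))

short-exists : ∀ {x y} → x ≼ y → rank y ≤ suc (rank x) →
               Σ Chain λ c → CoverPath P x c × lastOr x c ≡ y
short-exists {x} {y} x≼y short with equal-or-cover x y x≼y short
  where
  equal-or-cover : ∀ x y → x ≼ y → rank y ≤ suc (rank x) → x ≡ y ⊎ x ⋖ y
  equal-or-cover = from-yes (all? λ x → all? λ y → x ≼? y →-dec rank y ≤? suc (rank x) →-dec
                                                   (x ≟ᶠ y ⊎-dec x ⋖? y))
... | inj₁ x≡y = [] , tt , x≡y
... | inj₂ x⋖y = y ∷ [] , (x⋖y , tt) , refl

satChains : List Chain
satChains = [] ∷ (a₁ ∷ []) ∷ (b₁ ∷ []) ∷ (c₁ ∷ []) ∷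
            (a₁ ∷ t₂ ∷ []) ∷ (b₁ ∷ t₂ ∷ []) ∷ (c₁ ∷ t₂ ∷ []) ∷ (b₁ ∷ u₂ ∷ []) ∷ (c₁ ∷ u₂ ∷ []) ∷ []

-- Decidable equality of elements, at the size of E (fixed for module instantiation).
_≟ᴱ_ : (x y : E) → Dec (x ≡ y)
_≟ᴱ_ = _≟ᶠ_

open DecMembership (ListProperties.≡-dec _≟ᴱ_) using () renaming (_∈?_ to _∈ᶜ?_)

satChains-complete : ∀ {s} → SatChain P s → s ∈ satChains
satChains-complete {[]} _ = here refl
satChains-complete {x ∷ []} (0̂⋖x , _) = atoms x 0̂⋖x
  where
  atoms : ∀ x → 0̂ ⋖ x → (x ∷ []) ∈ satChains
  atoms = from-yes (all? λ x → 0̂ ⋖? x →-dec (x ∷ []) ∈ᶜ? satChains)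
satChains-complete {x ∷ y ∷ []} (0̂⋖x , x⋖y , _) = flags x y 0̂⋖x x⋖y
  where
  flags : ∀ x y → 0̂ ⋖ x → x ⋖ y → (x ∷ y ∷ []) ∈ satChains
  flags = from-yes (all? λ x → all? λ y → 0̂ ⋖? x →-dec x ⋖? y →-dec (x ∷ y ∷ []) ∈ᶜ? satChains)
satChains-complete {_ ∷ _ ∷ _ ∷ _} saturated = ⊥-elim (no-long-saturated saturated)

coverPath? : ∀ x c → Dec (CoverPath P x c)
coverPath? x []      = yes tt
coverPath? x (y ∷ c) = x ⋖? y ×-dec coverPath? y c

satChains-saturated : All (SatChain P) satChains
satChains-saturated = from-yes (All.all? (coverPath? 0̂) satChains)

for-all-saturated : ∀ {Q : Chain → Set} → All Q satChains → ∀ {s} → SatChain P s → Q s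
for-all-saturated all ss = All.lookup all (satChains-complete ss)

_⊆?_ : ∀ s s' → Dec (_⊆C_ P s s')
s ⊆? s' = map′ (λ s⊆s' a → s⊆s' {a}) (λ s⊆s' {a} → s⊆s' a) (s Subset.⊆? s')
  where module Subset = DecSubset _≟ᴱ_

ΛN : LabelPoset
ΛN = record { Carrier = ℕ ; _≤Λ_ = _≤_ ; isPartialOrder = ≤-isPartialOrder }

-- The labeling giving 0̂ ⋖ x the label `first x` and x ⋖ y the label `second x y`.
module EdgeLabeling (first : E → ℕ) (second : E → E → ℕ) where

  labelOf : Chain → ℕ
  labelOf (x ∷ [])     = first x
  labelOf (x ∷ y ∷ []) = second x y
  labelOf _            = 0

  lab : Labeling P ΛN
  lab m i = labelOf (take (suc i) m)

  -- A label only depends on the chain below it.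
  isC : IsCLabeling P ΛN lab
  isC m m' _ _ _ _ _ same i i<d = cong labelOf (take-prefix m m' i<d same)

  Ascends : E → E → Set
  Ascends x y = first x ≤ second x y × first x ≢ second x y

  IncreasingAtom : E → E → Set
  IncreasingAtom y x = 0̂ ⋖ x × x ⋖ y × Ascends x y

  Partner : E → E → E → Set
  Partner x y z = z ≢ x × 0̂ ⋖ z × z ⋖ y × first z ≡ second x y × second z y ≡ first x

  ascends? : ∀ x y → Dec (Ascends x y)
  ascends? x y = first x ≤? second x y ×-dec ¬? (first x ≟ℕ second x y)

  increasingAtom? : ∀ y x → Dec (IncreasingAtom y x)
  increasingAtom? y x = 0̂ ⋖? x ×-dec x ⋖? y ×-dec ascends? x y

  partner? : ∀ x y z → Dec (Partner x y z)
  partner? x y z = ¬? (z ≟ᶠ x) ×-dec 0̂ ⋖? z ×-dec z ⋖? y ×-dec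
                   first z ≟ℕ second x y ×-dec second z y ≟ℕ first x

  -- The three finite conditions making lab a CW-labeling:
  -- below each top there is exactly one increasing flag, ...
  UniqueIncreasingFlags : Set
  UniqueIncreasingFlags =
    ∀ y → rank y ≡ 2 → Σ E λ x → IncreasingAtom y x × (∀ x' → IncreasingAtom y x' → x' ≡ x)

  UniquePartners : Set
  UniquePartners =
    ∀ x y → IncreasingAtom y x → Σ E λ z → Partner x y z × (∀ z' → Partner x y z' → z' ≡ z)

  DistinctAscentFreeLabels : Set
  DistinctAscentFreeLabels =
    ∀ y x x' → 0̂ ⋖ x → x ⋖ y → 0̂ ⋖ x' → x' ⋖ y → ¬ Ascends x y → ¬ Ascends x' y →
    first x ≡ first x' → x ≡ x'

  CWConditions : Set
  CWConditions = UniqueIncreasingFlags × UniquePartners × DistinctAscentFreeLabels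

  cwConditions? : Dec CWConditions
  cwConditions? =
    (all? λ y → rank y ≟ℕ 2 →-dec any? λ x → increasingAtom? y x ×-dec
                  all? λ x' → increasingAtom? y x' →-dec x' ≟ᶠ x) ×-dec
    (all? λ x → all? λ y → increasingAtom? y x →-dec any? λ z → partner? x y z ×-dec
                  all? λ z' → partner? x y z' →-dec z' ≟ᶠ z) ×-dec
    (all? λ y → all? λ x → all? λ x' → 0̂ ⋖? x →-dec x ⋖? y →-dec 0̂ ⋖? x' →-dec x' ⋖? y →-dec
       ¬? (ascends? x y) →-dec ¬? (ascends? x' y) →-dec first x ≟ℕ first x' →-dec x ≟ᶠ x')

  switch-partner : ∀ {x y z} → Switch P ΛN lab (x ∷ y ∷ []) 1 z → Partner x y z
  switch-partner (x≢z , ((0̂⋖z , z⋖y , _) , _) , swapped) =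
    (λ z≡x → x≢z (cong just (sym z≡x))) , 0̂⋖z , z⋖y ,
    swapped 1 (s≤s z≤n) (s≤s z≤n) , swapped 2 (s≤s z≤n) (s≤s (s≤s z≤n))

  partner-switch : ∀ {x y z} → Partner x y z → Switch P ΛN lab (x ∷ y ∷ []) 1 z
  partner-switch {x} {y} {z} (z≢x , 0̂⋖z , z⋖y , first≡ , second≡) =
    (λ x≡z → z≢x (sym (just-injective x≡z))) , flag-maximal (flag 0̂⋖z z⋖y) , swapped
    where
    swapped : ∀ j → 1 ≤ j → j ≤ 2 →
              labelAt P ΛN lab (z ∷ y ∷ []) j ≡ labelAt P ΛN lab (x ∷ y ∷ []) (swapRank 1 j)
    swapped (suc zero)          _ _ = first≡
    swapped (suc (suc zero))    _ _ = second≡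
    swapped (suc (suc (suc _))) _ (s≤s (s≤s ()))

  interior-rank : ∀ {y i} → rank y ≡ 2 → 0 < i → i < rank y → i ≡ 1
  interior-rank rank≡2 0<i i<rank with subst (_ <_) rank≡2 i<rank
  interior-rank _ (s≤s z≤n) _ | s≤s (s≤s z≤n) = refl

  1<rank : ∀ {y} → rank y ≡ 2 → 1 < rank y
  1<rank rank≡2 = subst (1 <_) (sym rank≡2) (s≤s (s≤s z≤n))

  ascent-increasing : ∀ {x y} → rank y ≡ 2 → IncreasingAtom y x →
                      Increasing P ΛN lab [] y (x ∷ y ∷ [])
  ascent-increasing rank≡2 (0̂⋖x , x⋖y , ascends) i 0<i i<rank
    with interior-rank rank≡2 0<i i<rank
  ... | refl = [] , flag-maximal (flag 0̂⋖x x⋖y) , ascends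

  increasing-ascent : ∀ {x y} → rank y ≡ 2 → Increasing P ΛN lab [] y (x ∷ y ∷ []) → Ascends x y
  increasing-ascent rank≡2 increasing = proj₂ (proj₂ (increasing 1 (s≤s z≤n) (1<rank rank≡2)))

  ascent-free : ∀ {x y} → rank y ≡ 2 → 0̂ ⋖ x → x ⋖ y →
                AscentFree P ΛN lab [] y (x ∷ y ∷ []) → ¬ Ascends x y
  ascent-free rank≡2 0̂⋖x x⋖y free ascends =
    free 1 (s≤s z≤n) (1<rank rank≡2) ([] , flag-maximal (flag 0̂⋖x x⋖y) , ascends)

  UniqueIncreasingChain : Chain → E → Set
  UniqueIncreasingChain r y =
    Σ Chain λ c → (IntervalMaxChain P ΛN lab (top P r) y c × Increasing P ΛN lab r y c) ×
      (∀ c' → IntervalMaxChain P ΛN lab (top P r) y c' → Increasing P ΛN lab r y c' → c' ≡ c)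

  DistinctAscentFreeWords : Chain → E → Set
  DistinctAscentFreeWords r y = ∀ c c' t t' →
    IntervalMaxChain P ΛN lab (top P r) y c → IntervalMaxChain P ΛN lab (top P r) y c' →
    AscentFree P ΛN lab r y c → AscentFree P ΛN lab r y c' →
    MaxChain P ((r ++ c) ++ t) → MaxChain P ((r ++ c') ++ t') →
    (∀ i → rank (top P r) < i → i < rank y →
       labelAt P ΛN lab ((r ++ c) ++ t) i ≡ labelAt P ΛN lab ((r ++ c') ++ t') i) →
    c ≡ c'

  module _ (conditions : CWConditions) where
    private
      unique-increasing : UniqueIncreasingFlags
      unique-increasing = proj₁ conditions
      unique-partner : UniquePartners
      unique-partner = proj₁ (proj₂ conditions)
      distinct-labels : DistinctAscentFreeLabels
      distinct-labels = proj₂ (proj₂ conditions)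

    -- Short rooted intervals have a single maximal chain; [0̂ , y] has one increasing flag.
    isCR : IsCRLabeling P ΛN lab
    isCR = isC , rooted
      where
      rooted : ∀ r y → SatChain P r → top P r ≼ y → UniqueIncreasingChain r y
      rooted r y sr r≼y with rooted-cases sr r≼y
      ... | inj₁ short with short-exists r≼y short
      ...   | c , path , last =
        c , ((path , last) , λ i lo hi → ⊥-elim (<-irrefl refl (≤-trans hi (≤-trans short lo))))
          , λ c' (path' , last') _ → short-unique short path' last' path last
      rooted _ y _ _ | inj₂ (refl , rank≡2) with unique-increasing y rank≡2
      ... | x , increasing , unique =
        x ∷ y ∷ [] , (((proj₁ increasing , proj₁ (proj₂ increasing) , tt) , refl)
                   , ascent-increasing rank≡2 increasing)
          , λ c' (path' , last') increasing' →
              same-flag (interval-flag rank≡2 path' last') increasing'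
        where
        same-flag : ∀ {c'} → Flag y c' → Increasing P ΛN lab [] y c' → c' ≡ x ∷ y ∷ []
        same-flag (flag 0̂⋖x' x'⋖y) increasing' =
          cong (_∷ y ∷ []) (unique _ (0̂⋖x' , x'⋖y , increasing-ascent rank≡2 increasing'))

    switching : ∀ {y m} → Flag y m → ∀ i → 1 ≤ i → i < length m → AscentAt P ΛN lab m i →
                Σ E λ z → Switch P ΛN lab m i z × (∀ z' → Switch P ΛN lab m i z' → z' ≡ z)
    switching (flag 0̂⋖x x⋖y) (suc zero) _ _ ascends
      with unique-partner _ _ (0̂⋖x , x⋖y , ascends)
    ... | z , partner , unique = z , partner-switch partner , λ z' → unique z' ∘ switch-partner
    switching (flag _ _) (suc (suc _)) _ (s≤s (s≤s ())) _

    -- ... and, as maximal chains are determined by their bottom two elements, local.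
    switching-local : ∀ {y y' m m'} → Flag y m → Flag y' m' → ∀ i z z' →
                      1 ≤ i → i < length m → AscentAt P ΛN lab m i →
                      take (suc i) m ≡ take (suc i) m' →
                      Switch P ΛN lab m i z → Switch P ΛN lab m' i z' → z ≡ z'
    switching-local f@(flag _ _) (flag _ _) (suc zero) z z' 1≤i i<len ascends refl switch switch' =
      let _ , _ , unique = switching f 1 1≤i i<len ascends in
      trans (unique z switch) (sym (unique z' switch'))
    switching-local (flag _ _) _ (suc (suc _)) _ _ _ (s≤s (s≤s ())) _ _ _ _

    -- Distinct ascent-free flags below y differ in their first label, hence in their words.
    isCW : IsCWLabeling P ΛN lab
    isCW = isCR
         , ( (λ m i maximal → switching (maximal-flag maximal) i)
           , (λ m m' i z z' maximal maximal' 1≤i i<len _ ascends _ →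
                  switching-local (maximal-flag maximal) (maximal-flag maximal')
                                i z z' 1≤i i<len ascends) )
         , words
      where
      words : ∀ r y → SatChain P r → top P r ≼ y → DistinctAscentFreeWords r y
      words r y sr r≼y c c' t t' (path , last) (path' , last') free free' _ _ same
        with rooted-cases sr r≼y
      ... | inj₁ short = short-unique short path last path' last'
      ... | inj₂ (refl , rank≡2)
        with interval-flag rank≡2 path last | interval-flag rank≡2 path' last'
      ... | flag 0̂⋖x x⋖y | flag 0̂⋖x' x'⋖y =
        cong (_∷ y ∷ []) (distinct-labels y _ _ 0̂⋖x x⋖y 0̂⋖x' x'⋖y
          (ascent-free rank≡2 0̂⋖x x⋖y free) (ascent-free rank≡2 0̂⋖x' x'⋖y free')
          (same 1 (s≤s z≤n) (1<rank rank≡2)))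

  -- The quadratic exchanges of lab: swapping the atom of an increasing flag for its partner.
  data Exchange : Chain → Chain → Set where
    exchange : ∀ {x y z} → IncreasingAtom y x → Partner x y z → Exchange (x ∷ y ∷ []) (z ∷ y ∷ [])

  exchange-quad : ∀ {s s'} → Exchange s s' → QuadExchange P ΛN lab s s'
  exchange-quad (exchange (0̂⋖x , x⋖y , ascends) partner) =
    (0̂⋖x , x⋖y , tt) , 1 , [] , _ , s≤s z≤n , s≤s (s≤s z≤n) ,
    flag-maximal (flag 0̂⋖x x⋖y) , ascends , partner-switch partner , refl

  quad-exchange : ∀ {s s'} → QuadExchange P ΛN lab s s' → Exchange s s'
  quad-exchange {x ∷ y ∷ []}
    ((0̂⋖x , x⋖y , _) , suc zero , _ , _ , _ , _ , maximal , ascends , switch , refl)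
    with maximal-flag maximal
  ... | flag _ _ = exchange (0̂⋖x , x⋖y , ascends) (switch-partner switch)
  quad-exchange {x ∷ y ∷ []} (_ , suc (suc _) , _ , _ , _ , s≤s (s≤s ()) , _)
  quad-exchange {_ ∷ _ ∷ _ ∷ _} (saturated , _) = ⊥-elim (no-long-saturated saturated)
  quad-exchange {[]} (_ , suc _ , _ , _ , _ , () , _)
  quad-exchange {_ ∷ []} (_ , suc _ , _ , _ , _ , s≤s () , _)

  exchange? : ∀ s s' → Dec (Exchange s s')
  exchange? (x ∷ y ∷ []) (z ∷ y' ∷ []) with y ≟ᶠ y'
  ... | no y≢y' = no λ { (exchange _ _) → y≢y' refl }
  ... | yes refl = map′ (uncurry exchange) (λ { (exchange i p) → i , p })
                        (increasingAtom? y x ×-dec partner? x y z)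
  exchange? []                _                 = no λ ()
  exchange? (_ ∷ [])          _                 = no λ ()
  exchange? (_ ∷ _ ∷ _ ∷ _)   _                 = no λ ()
  exchange? (_ ∷ _ ∷ [])      []                = no λ ()
  exchange? (_ ∷ _ ∷ [])      (_ ∷ [])          = no λ ()
  exchange? (_ ∷ _ ∷ [])      (_ ∷ _ ∷ _ ∷ _)   = no λ ()

  open Quotient P ΛN lab using (_≈_; ≈-refl; module ClassMap)

  exchange-≈ : ∀ {s s'} → Exchange s s' → s ≈ s'
  exchange-≈ e@(exchange (0̂⋖x , x⋖y , _) (_ , 0̂⋖z , z⋖y , _)) =
    (0̂⋖x , x⋖y , tt) , (0̂⋖z , z⋖y , tt) , refl , fwd (exchange-quad e) ◅ ε

  -- κ sends a saturated chain to its class, ordered by `order`, with representatives `rep`.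
  record QuotientTable (n : ℕ) : Set where
    field
      κ     : Chain → Fin n
      order : Fin n → Fin n → Bool
      rep   : Fin n → Chain

  module _ {n} (table : QuotientTable n) where
    open QuotientTable table

    _≤ₖ_ : Fin n → Fin n → Set
    k ≤ₖ l = T (order k l)

    -- The finite facts making κ an isomorphism of Q_λ(P) with (Fin n , order):
    -- the order is transitive, ...
    OrderTransitive : Set
    OrderTransitive = ∀ k l m → k ≤ₖ l → l ≤ₖ m → k ≤ₖ m

    RespectsExchanges : Set
    RespectsExchanges =
      ∀ x y z → IncreasingAtom y x → Partner x y z → κ (x ∷ y ∷ []) ≡ κ (z ∷ y ∷ [])

    MonotoneOnChains : Set
    MonotoneOnChains = All (λ s → All (λ s' → _⊆C_ P s s' → κ s ≤ₖ κ s') satChains) satChains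

    RepresentativesReach : Set
    RepresentativesReach = All (λ s → rep (κ s) ≡ s ⊎ Exchange (rep (κ s)) s) satChains

    OrderRealised : Set
    OrderRealised = ∀ k l → k ≤ₖ l → Any (λ s → κ s ≡ l × _⊆C_ P (rep k) s) satChains

    TableConditions : Set
    TableConditions =
      OrderTransitive × RespectsExchanges × MonotoneOnChains × RepresentativesReach × OrderRealised

    tableConditions? : Dec TableConditions
    tableConditions? =
      (all? λ k → all? λ l → all? λ m →
         T? (order k l) →-dec T? (order l m) →-dec T? (order k m)) ×-dec
      (all? λ x → all? λ y → all? λ z → increasingAtom? y x →-dec partner? x y z →-dec
         κ (x ∷ y ∷ []) ≟ᶠ κ (z ∷ y ∷ [])) ×-dec
      All.all? (λ s → All.all? (λ s' → s ⊆? s' →-dec T? (order (κ s) (κ s'))) satChains)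
               satChains ×-dec
      All.all? (λ s → ListProperties.≡-dec _≟ᴱ_ (rep (κ s)) s ⊎-dec exchange? (rep (κ s)) s)
               satChains ×-dec
      (all? λ k → all? λ l → T? (order k l) →-dec
         Any.any? (λ s → κ s ≟ᶠ l ×-dec rep k ⊆? s) satChains)

    module TableModel (conditions : TableConditions) where
      private
        ≤ₖ-trans : OrderTransitive
        ≤ₖ-trans = proj₁ conditions
        respects : RespectsExchanges
        respects = proj₁ (proj₂ conditions)
        monotone : MonotoneOnChains
        monotone = proj₁ (proj₂ (proj₂ conditions))
        reps : RepresentativesReach
        reps = proj₁ (proj₂ (proj₂ (proj₂ conditions)))
        realisable : OrderRealised
        realisable = proj₂ (proj₂ (proj₂ (proj₂ conditions)))

        respects-exchange : ∀ {s s'} → Exchange s s' → κ s ≡ κ s'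
        respects-exchange (exchange increasing partner) = respects _ _ _ increasing partner

      open ClassMap κ _≤ₖ_ (λ {k} {l} {m} → ≤ₖ-trans k l m)
        (λ quad → respects-exchange (quad-exchange quad))
        (λ ss ss' → All.lookup (for-all-saturated monotone ss) (satChains-complete ss'))
        public

      rep-≈ : ∀ {s} → SatChain P s → rep (κ s) ≈ s
      rep-≈ {s} ss with for-all-saturated reps ss
      ... | inj₁ rep≡s = subst (_≈ s) (sym rep≡s) (≈-refl ss)
      ... | inj₂ e     = exchange-≈ e

      realised : ∀ {k l} → k ≤ₖ l → Σ Chain λ s → SatChain P s × κ s ≡ l × _⊆C_ P (rep k) s
      realised {k} {l} k≤l with find (realisable k l k≤l)
      ... | s , s∈ , κs≡l , rep⊆s = s , All.lookup satChains-saturated s∈ , κs≡l , rep⊆s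

      open Complete rep rep-≈ realised public

-- λ₁: atoms a₁ b₁ c₁ labelled 1 2 3; the increasing flags are a₁t₂ and b₁u₂.
first₁ : E → ℕ
first₁ a₁ = 1
first₁ b₁ = 2
first₁ c₁ = 3
first₁ _  = 0

second₁ : E → E → ℕ
second₁ a₁ t₂ = 2
second₁ b₁ t₂ = 1
second₁ c₁ t₂ = 1
second₁ b₁ u₂ = 3
second₁ c₁ u₂ = 2
second₁ _  _  = 0

-- λ₂: atoms labelled 3 1 2; the increasing flags are b₁t₂ and b₁u₂.
first₂ : E → ℕ
first₂ a₁ = 3
first₂ b₁ = 1
first₂ c₁ = 2
first₂ _  = 0

second₂ : E → E → ℕ
second₂ a₁ t₂ = 1
second₂ b₁ t₂ = 2
second₂ c₁ t₂ = 1
second₂ b₁ u₂ = 2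
second₂ c₁ u₂ = 1
second₂ _  _  = 0

module λ₁ = EdgeLabeling first₁ second₁
module λ₂ = EdgeLabeling first₂ second₂

-- Q_{λ₁}(P): classes [], a₁, b₁, c₁, {a₁t₂ , b₁t₂}, {c₁t₂}, {b₁u₂ , c₁u₂} numbered 0 … 6;
-- above the atoms its Hasse diagram is the path 1 — 4 — 2 — 6 — 3 — 5.
table₁ : λ₁.QuotientTable 7
table₁ = record
  { κ = λ where
      (a₁ ∷ [])      → # 1
      (b₁ ∷ [])      → # 2
      (c₁ ∷ [])      → # 3
      (a₁ ∷ t₂ ∷ []) → # 4
      (b₁ ∷ t₂ ∷ []) → # 4
      (c₁ ∷ t₂ ∷ []) → # 5
      (b₁ ∷ u₂ ∷ []) → # 6
      (c₁ ∷ u₂ ∷ []) → # 6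
      _              → # 0
  ; order = heightTwo ((# 1 , # 4) ∷ (# 2 , # 4) ∷ (# 2 , # 6) ∷ (# 3 , # 6) ∷ (# 3 , # 5) ∷ [])
  ; rep = lookup ([] ∷ (a₁ ∷ []) ∷ (b₁ ∷ []) ∷ (c₁ ∷ []) ∷
                  (a₁ ∷ t₂ ∷ []) ∷ (c₁ ∷ t₂ ∷ []) ∷ (b₁ ∷ u₂ ∷ []) ∷ [])
  }

-- Q_{λ₂}(P): classes [], a₁, b₁, c₁, {a₁t₂}, {b₁t₂ , c₁t₂}, {b₁u₂ , c₁u₂} numbered 0 … 6;
-- above the atoms its Hasse diagram is the edge 1 — 4 and the square 2 , 3 — 5 , 6.
table₂ : λ₂.QuotientTable 7
table₂ = record
  { κ = λ where
      (a₁ ∷ [])      → # 1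
      (b₁ ∷ [])      → # 2
      (c₁ ∷ [])      → # 3
      (a₁ ∷ t₂ ∷ []) → # 4
      (b₁ ∷ t₂ ∷ []) → # 5
      (c₁ ∷ t₂ ∷ []) → # 5
      (b₁ ∷ u₂ ∷ []) → # 6
      (c₁ ∷ u₂ ∷ []) → # 6
      _              → # 0
  ; order = heightTwo ((# 1 , # 4) ∷ (# 2 , # 5) ∷ (# 2 , # 6) ∷ (# 3 , # 5) ∷ (# 3 , # 6) ∷ [])
  ; rep = lookup ([] ∷ (a₁ ∷ []) ∷ (b₁ ∷ []) ∷ (c₁ ∷ []) ∷
                  (a₁ ∷ t₂ ∷ []) ∷ (b₁ ∷ t₂ ∷ []) ∷ (b₁ ∷ u₂ ∷ []) ∷ [])
  }

module Q₁ = λ₁.TableModel table₁ (from-yes (λ₁.tableConditions? table₁))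
module Q₂ = λ₂.TableModel table₂ (from-yes (λ₂.tableConditions? table₂))

no-crown₁ : ¬ Quotient.Crown P ΛN λ₁.lab
no-crown₁ = Q₁.no-crown (from-yes (all? λ k → all? λ l → all? λ m → all? λ n → ¬? (crown? k l m n)))
  where
  _≤ₖ?_ : ∀ k l → Dec (λ₁._≤ₖ_ table₁ k l)
  k ≤ₖ? l = T? _
  crown? : ∀ k l m n → Dec (Q₁.ClassCrown k l m n)
  crown? k l m n = ¬? (k ≤ₖ? l) ×-dec ¬? (l ≤ₖ? k) ×-dec k ≤ₖ? m ×-dec k ≤ₖ? n ×-dec
                   l ≤ₖ? m ×-dec l ≤ₖ? n ×-dec ¬? (m ≟ᶠ n)

-- ... while b₁ and c₁ lie below both b₁t₂ and b₁u₂ in the square.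
crown₂ : Quotient.Crown P ΛN λ₂.lab
crown₂ = Q₂.crown-of-classes
  {x = b₁ ∷ []} {y = c₁ ∷ []} {z = b₁ ∷ t₂ ∷ []} {w = b₁ ∷ u₂ ∷ []}
  (from-yes (coverPath? 0̂ (b₁ ∷ []))) (from-yes (coverPath? 0̂ (c₁ ∷ [])))
  (from-yes (coverPath? 0̂ (b₁ ∷ t₂ ∷ []))) (from-yes (coverPath? 0̂ (b₁ ∷ u₂ ∷ [])))
  ((λ ()) , (λ ()) , tt , tt , tt , tt , λ ())

theorem5p22 : Σ GradedPoset λ P →
              Σ LabelPoset λ Λ₁ → Σ (Labeling P Λ₁) λ λ₁ →
              Σ LabelPoset λ Λ₂ → Σ (Labeling P Λ₂) λ λ₂ →
              IsCWLabeling P Λ₁ λ₁ × IsCWLabeling P Λ₂ λ₂ ×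
              ¬ QIso P Λ₁ λ₁ Λ₂ λ₂
theorem5p22 =
  P , ΛN , λ₁.lab , ΛN , λ₂.lab ,
  λ₁.isCW (from-yes λ₁.cwConditions?) ,
  λ₂.isCW (from-yes λ₂.cwConditions?) ,
  λ iso → no-crown₁ (crown-reflected P ΛN λ₁.lab ΛN λ₂.lab iso crown₂)
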